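{- Let $G$ be an oriented graph and let $u,v$ be a pair of vertices of $G$ that are neither adjacent nor at directed distance $2$ (in either direction). Then $cl(G)_{uv}\subseteq cl(G_{uv})$, where in both graphs the vertex obtained by identifying $u$ and $v$ is denoted by the same name $u_v$ (so both graphs have the same vertex set).
   Context: An oriented graph is a simple loopless graph in which each edge is assigned a direction. For a graph or oriented graph $\Gamma$ and non-adjacent vertices $u,v$, $\Gamma_{uv}$ denotes the graph (resp. oriented graph) obtained by identifying $u$ and $v$ into a single new vertex $u_v$, i.e. $u_v$ is adjacent to (resp. has as in-/out-neighbours) the union of the neighbours (resp. in-/out-neighbours) of $u$ and $v$, with multiple edges merged; when $u,v$ are not the ends of a directed $2$-path in an oriented graph, $G_{uv}$ is again an oriented graph. The undirected closure $cl(G)$ of an oriented graph $G$ is the simple graph on $V(G)$ in which $x,y$ are adjacent if and only if they are at directed distance at most $2$ in $G$, i.e. $xy$ or $yx$ is an arc, or there is a directed path of length $2$ from $x$ to $y$ or from $y$ to $x$. For graphs on the same vertex set, $\subseteq$ means edge-set containment. -}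

module Defs where

open import Data.Nat using (ℕ)
open import Data.Fin using (Fin; _≟_)
open import Data.Product using (Σ; ∃; ∃-syntax; _×_; _,_; proj₁)
open import Data.Sum using (_⊎_)
open import Relation.Binary.PropositionalEquality using (_≡_; _≢_)
open import Relation.Nullary using (¬_; yes; no)

record OrientedGraph (n : ℕ) : Set₁ where
  field
    Arc   : Fin n → Fin n → Set
    irrefl : ∀ x → ¬ Arc x x
    asym   : ∀ x y → Arc x y → ¬ Arc y x
open OrientedGraph public

Path2 : {V : Set} → (V → V → Set) → V → V → Set
Path2 A x y = ∃[ z ] (A x z × A z y)

Closure : {V : Set} → (V → V → Set) → V → V → Set
Closure A x y = x ≢ y × (A x y ⊎ A y x ⊎ Path2 A x y ⊎ Path2 A y x)

-- Vertex set after identifying u and v: all vertices except v;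
-- the vertex u plays the role of the identified vertex u_v.
Merged : (n : ℕ) → Fin n → Set
Merged n v = Σ (Fin n) (λ x → x ≢ v)

merge : {n : ℕ} (u v : Fin n) → u ≢ v → Fin n → Merged n v
merge u v u≢v x with x ≟ v
... | yes _   = u , u≢v
... | no x≢v  = x , x≢v

-- Identification of u and v in a relation R on Fin n (used both for the
-- arc relation of an oriented graph, giving G_uv, and for the adjacency of a
-- graph, giving Γ_uv): images of related pairs are related (multiple edges merged).
Identify : {n : ℕ} (R : Fin n → Fin n → Set) (u v : Fin n) → u ≢ v →
           Merged n v → Merged n v → Set
Identify R u v u≢v a b =
  ∃[ x ] ∃[ y ] (merge u v u≢v x ≡ a × merge u v u≢v y ≡ b × R x y)

_⊆ᴳ_ : {V : Set} → (V → V → Set) → (V → V → Set) → Set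
R ⊆ᴳ S = ∀ x y → R x y → S x y

module Submission where

open import Defs
open import Data.Nat using (ℕ)
open import Data.Fin using (Fin; _≟_)
open import Data.Product using (_×_; _,_; proj₁)
open import Data.Sum using (_⊎_; inj₁; inj₂)
open import Relation.Binary.PropositionalEquality using (_≡_; _≢_; refl; sym; trans; cong)
open import Relation.Nullary using (¬_; yes; no)

-- Identifying u and v only glues the pair {u, v}, and that pair is far apart, so
-- two distinct vertices at distance at most 2 stay distinct after the merge.
-- Distance at most 2 is preserved by any arc-preserving map, in particular by
-- the quotient map G → G_uv.

Near : {V : Set} → (V → V → Set) → V → V → Set
Near A x y = A x y ⊎ A y x ⊎ Path2 A x y ⊎ Path2 A y x

Near-sym : {V : Set} {A : V → V → Set} {x y : V} → Near A x y → Near A y x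
Near-sym (inj₁ p)               = inj₂ (inj₁ p)
Near-sym (inj₂ (inj₁ p))        = inj₁ p
Near-sym (inj₂ (inj₂ (inj₁ p))) = inj₂ (inj₂ (inj₂ p))
Near-sym (inj₂ (inj₂ (inj₂ p))) = inj₂ (inj₂ (inj₁ p))

Near-map : {V W : Set} {A : V → V → Set} {B : W → W → Set} (f : V → W) →
  (∀ {x y} → A x y → B (f x) (f y)) →
  ∀ {x y} → Near A x y → Near B (f x) (f y)
Near-map f hom (inj₁ p)                           = inj₁ (hom p)
Near-map f hom (inj₂ (inj₁ p))                    = inj₂ (inj₁ (hom p))
Near-map f hom (inj₂ (inj₂ (inj₁ (z , p , q))))   = inj₂ (inj₂ (inj₁ (f z , hom p , hom q)))
Near-map f hom (inj₂ (inj₂ (inj₂ (z , p , q))))   = inj₂ (inj₂ (inj₂ (f z , hom p , hom q)))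

module _ {n : ℕ} (u v : Fin n) (u≢v : u ≢ v) where

  private
    m : Fin n → Merged n v
    m = merge u v u≢v

  merge-≡ : ∀ x y → m x ≡ m y → x ≡ y ⊎ (x ≡ v × y ≡ u) ⊎ (x ≡ u × y ≡ v)
  merge-≡ x y e with x ≟ v | y ≟ v
  ... | yes x≡v | yes y≡v = inj₁ (trans x≡v (sym y≡v))
  ... | yes x≡v | no _    = inj₂ (inj₁ (x≡v , sym (cong proj₁ e)))
  ... | no _    | yes y≡v = inj₂ (inj₂ (cong proj₁ e , y≡v))
  ... | no _    | no _    = inj₁ (cong proj₁ e)

  merge-hom : {R : Fin n → Fin n → Set} {x y : Fin n} →
    R x y → Identify R u v u≢v (m x) (m y)
  merge-hom {x = x} {y} r = x , y , refl , refl , r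

  merge-injective-on-Near : {A : Fin n → Fin n → Set} → ¬ Near A u v →
    ∀ {x y} → x ≢ y → Near A x y → m x ≢ m y
  merge-injective-on-Near {A} far {x} {y} x≢y near e with merge-≡ x y e
  ... | inj₁ x≡y                  = x≢y x≡y
  ... | inj₂ (inj₁ (refl , refl)) = far (Near-sym {A = A} near)
  ... | inj₂ (inj₂ (refl , refl)) = far near

lemma7 : {n : ℕ} (G : OrientedGraph n) (u v : Fin n) (u≢v : u ≢ v) →
    ¬ Arc G u v → ¬ Arc G v u →
    ¬ Path2 (Arc G) u v → ¬ Path2 (Arc G) v u →
    Identify (Closure (Arc G)) u v u≢v ⊆ᴳ Closure (Identify (Arc G) u v u≢v)
lemma7 G u v u≢v ¬uv ¬vu ¬u⇉v ¬v⇉u _ _ (x , y , refl , refl , x≢y , near) =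
  merge-injective-on-Near u v u≢v far x≢y near ,
  Near-map {B = Identify (Arc G) u v u≢v} (merge u v u≢v) (merge-hom u v u≢v) near
  where
  far : ¬ Near (Arc G) u v
  far (inj₁ p)               = ¬uv p
  far (inj₂ (inj₁ p))        = ¬vu p
  far (inj₂ (inj₂ (inj₁ p))) = ¬u⇉v p
  far (inj₂ (inj₂ (inj₂ p))) = ¬v⇉u p
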